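{- Let $I$ be an ideal of the multilinear polynomial ring $\mathbb{F}[x,y,z,\dots]/\langle x^2-x,y^2-y,z^2-z,\dots\rangle$, let $T$ be a term irreducible modulo $I$, and let $\rho$ be any partial assignment of variables in $\mathrm{vars}(T)$ to values in $\mathbb{F}$ such that the restricted term $T|_\rho\ne0$. Then $T|_\rho$ is also irreducible modulo $I$.
   Context: $\mathbb{F}$ is a field; products are multilinearized. A term is a nonzero scalar times a multilinear monomial; $T|_\rho$ denotes the result of substituting the values given by $\rho$ for the corresponding variables of $T$. Fix an admissible total order $\prec$ on multilinear monomials: $\deg m_1<\deg m_2$ implies $m_1\prec m_2$, and $m_1\prec m_2$ with $\mathrm{vars}(m)\cap(\mathrm{vars}(m_1)\cup\mathrm{vars}(m_2))=\emptyset$ implies $mm_1\prec mm_2$; terms are ordered by their monomials and $\mathrm{LT}(P)$ is the largest term of $P$. A term $T$ is reducible modulo $I$ if $T=\mathrm{LT}(Q)$ for some $Q\in I$, and irreducible otherwise. -}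

module Defs where

open import Level using (Level; _⊔_; suc)
open import Algebra.Bundles using (CommutativeRing)
open import Data.Bool using (Bool; true; false; _∧_; _∨_; not; if_then_else_)
open import Data.Nat using (ℕ; _<_)
open import Data.Nat as ℕ using ()
open import Data.Fin using (Fin)
open import Data.Vec as Vec using (Vec; lookup; zipWith; count)
open import Data.Vec.Properties using (≡-dec)
import Data.Bool.Properties as BoolP
open import Data.List as List using (List; []; _++_; concatMap; map; foldr)
open import Data.Maybe using (Maybe; just; nothing; is-nothing)
open import Data.Product using (Σ; ∃; _×_; _,_; proj₁; proj₂)
open import Data.Sum using (_⊎_)
open import Relation.Nullary using (¬_; Dec; yes; no)
open import Relation.Binary.PropositionalEquality using (_≡_)
open import Relation.Binary.Structures using (IsStrictTotalOrder)
open import Relation.Binary.Core using (Rel)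

record Field (c ℓ : Level) : Set (suc (c ⊔ ℓ)) where
  field
    commutativeRing : CommutativeRing c ℓ
  open CommutativeRing commutativeRing public
  field
    1≉0     : 1# ≉ 0#
    inverse : ∀ x → x ≉ 0# → ∃ λ y → x * y ≈ 1#

-- Multilinear monomials in the variables x₀ … x_{n-1}:
-- a monomial is the set of variables occurring in it, as a Vec Bool n.

Mono : ℕ → Set
Mono n = Vec Bool n

-- multilinear product of monomials (x² = x): union of variable sets
_·ₘ_ : ∀ {n} → Mono n → Mono n → Mono n
_·ₘ_ = zipWith _∨_

deg : ∀ {n} → Mono n → ℕ
deg m = count (λ b → BoolP.T? b) m

Disjoint : ∀ {n} → Mono n → Mono n → Set
Disjoint m m' = ∀ i → lookup m i ∧ lookup m' i ≡ false

_≟ₘ_ : ∀ {n} (m m' : Mono n) → Dec (m ≡ m')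
_≟ₘ_ = ≡-dec BoolP._≟_

record Admissible (n : ℕ) (_≺_ : Rel (Mono n) Level.zero) : Set where
  field
    isStrictTotalOrder : IsStrictTotalOrder _≡_ _≺_
    deg-mono : ∀ m₁ m₂ → deg m₁ < deg m₂ → m₁ ≺ m₂
    mul-mono : ∀ m m₁ m₂ → m₁ ≺ m₂ → Disjoint m (m₁ ·ₘ m₂) →
               (m ·ₘ m₁) ≺ (m ·ₘ m₂)

-- Multilinear polynomials over a field F in n variables, i.e. elements
-- of F[x₀,…,x_{n-1}]/⟨x_i² - x_i⟩, represented as formal sums of
-- (coefficient, monomial) pairs; equality is equality of all coefficients.

module Poly {c ℓ} (F : Field c ℓ) (n : ℕ) where
  open Field F

  -- a term c·m (nonzeroness of c is stated separately where needed)
  TermRep : Set c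
  TermRep = Carrier × Mono n

  Pol : Set c
  Pol = List TermRep

  coeff : Pol → Mono n → Carrier
  coeff p m = foldr (λ t acc → (if isYes (proj₂ t ≟ₘ m) then proj₁ t else 0#) + acc) 0# p
    where
    isYes : ∀ {a} {A : Set a} → Dec A → Bool
    isYes (yes _) = true
    isYes (no _)  = false

  _≈ₚ_ : Pol → Pol → Set ℓ
  p ≈ₚ q = ∀ m → coeff p m ≈ coeff q m

  0ₚ : Pol
  0ₚ = []

  _+ₚ_ : Pol → Pol → Pol
  _+ₚ_ = _++_

  _*ₚ_ : Pol → Pol → Pol
  p *ₚ q = concatMap (λ t → map (λ u → (proj₁ t * proj₁ u , proj₂ t ·ₘ proj₂ u)) q) p

  record IsIdeal {ℓ'} (I : Pol → Set ℓ') : Set (c ⊔ ℓ ⊔ ℓ') where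
    field
      resp-≈ : ∀ {p q} → p ≈ₚ q → I p → I q
      zero∈  : I 0ₚ
      +-closed : ∀ {p q} → I p → I q → I (p +ₚ q)
      *-closed : ∀ q {p} → I p → I (q *ₚ p)

  module _ (_≺_ : Rel (Mono n) Level.zero) where

    IsLT : Pol → Carrier → Mono n → Set ℓ
    IsLT Q a m = coeff Q m ≉ 0# × coeff Q m ≈ a ×
                 (∀ m' → coeff Q m' ≉ 0# → m' ≡ m ⊎ m' ≺ m)

    Reducible : ∀ {ℓ'} → (Pol → Set ℓ') → Carrier → Mono n → Set (c ⊔ ℓ ⊔ ℓ')
    Reducible I a m = Σ Pol λ Q → I Q × IsLT Q a m

    Irreducible : ∀ {ℓ'} → (Pol → Set ℓ') → Carrier → Mono n → Set (c ⊔ ℓ ⊔ ℓ')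
    Irreducible I a m = ¬ Reducible I a m

  -- partial assignments: ρ i = just v assigns v to x_i, nothing leaves it free
  PAssign : Set c
  PAssign = Vec (Maybe Carrier) n

  DomWithin : PAssign → Mono n → Set c
  DomWithin ρ m = ∀ i v → lookup ρ i ≡ just v → lookup m i ≡ true

  -- T|_ρ for T = a·m: coefficient a · ∏_{x_i ∈ vars(m), ρ i = just v} v,
  -- monomial: the variables of m not assigned by ρ
  restrictCoeff : PAssign → Carrier → Mono n → Carrier
  restrictCoeff ρ a m = Vec.foldr _ (λ x acc → x * acc) a
    (zipWith (λ b r → if b then val r else 1#) m ρ)
    where
    val : Maybe Carrier → Carrier
    val (just v) = v
    val nothing  = 1#

  restrictMono : PAssign → Mono n → Mono n
  restrictMono ρ m = zipWith (λ b r → b ∧ is-nothing r) m ρ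

-- Reducibility of
-- c·ν is preserved under (i) replacing c by any nonzero scalar — multiply Q by a
-- constant — and (ii) adjoining a variable xᵢ ∉ ν — multiply Q by xᵢ.  For (ii), the
-- coefficient of xᵢν in xᵢQ is Q(xᵢν) + Q(ν) = Q(ν), and a monomial μ ≻ xᵢν in the
-- support of xᵢQ would contain xᵢ with Q(μ) + Q(μ/xᵢ) ≠ 0; but μ ≻ ν, and μ/xᵢ ≻ ν
-- since otherwise μ ≼ xᵢν by admissibility.  As T|ρ = c′·m′ with m′ ⊆ m, if T|ρ were
-- reducible then so would be c′·m and hence T.

module Submission where

open import Defs
open import Level using (Level)
open import Algebra.Properties.CommutativeSemigroup using (interchange)
open import Data.Bool using (true; false; _∧_; _∨_)
open import Data.Bool.Properties using (∧-conicalˡ)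
open import Data.Empty using (⊥-elim)
open import Data.Fin using (Fin; zero; suc; _≟_)
open import Data.List using (List; []; _∷_; [_]; _++_; map; allFin)
open import Data.List.Properties using (++-identityʳ)
open import Data.List.Membership.Propositional using (_∉_)
open import Data.List.Membership.Propositional.Properties using (∈-allFin)
open import Data.List.Relation.Unary.Any using (here; there)
open import Data.Maybe using (is-nothing)
open import Data.Nat using (ℕ; suc; _<_)
open import Data.Nat.Properties using (n<1+n)
open import Data.Product using (_,_; proj₁; proj₂)
open import Data.Sum using (_⊎_; inj₁; inj₂; [_,_]′)
open import Data.Vec using (Vec; _∷_; lookup; replicate; _[_]≔_)
open import Data.Vec.Properties
  using (lookup-zipWith; lookup-replicate; lookup∘update; lookup∘update′;
         []≔-idempotent; updateAt-id-local; zipWith-replicate₁; map-id)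
open import Data.Vec.Relation.Binary.Pointwise.Extensional using (ext; Pointwise-≡⇒≡)
open import Function using (case_of_)
open import Relation.Binary.Core using (Rel)
open import Relation.Binary.Definitions using (tri<; tri≈; tri>)
open import Relation.Binary.PropositionalEquality as ≡ using (_≡_; _≢_; refl)
open import Relation.Binary.Structures using (IsStrictTotalOrder)
open import Relation.Nullary using (¬_; yes; no; contradiction)

private
  variable
    a : Level
    A : Set a
    n : ℕ

true≢false : true ≢ false
true≢false ()

update-id : ∀ (xs : Vec A n) i {x} → lookup xs i ≡ x → xs [ i ]≔ x ≡ xs
update-id xs i xsᵢ = updateAt-id-local i xs (≡.sym xsᵢ)

update-≢ : ∀ (xs : Vec A n) i {x} → lookup xs i ≢ x → xs ≢ xs [ i ]≔ x
update-≢ xs i {x} xsᵢ≢x xs≡ = xsᵢ≢x (≡.trans (≡.cong (λ ys → lookup ys i) xs≡) (lookup∘update i xs x))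

AgreeOutside : List (Fin n) → Vec A n → Vec A n → Set _
AgreeOutside L xs ys = ∀ j → j ∉ L → lookup xs j ≡ lookup ys j

agreeOutside-[]⇒≡ : ∀ {xs ys : Vec A n} → AgreeOutside [] xs ys → xs ≡ ys
agreeOutside-[]⇒≡ agree = Pointwise-≡⇒≡ (ext λ j → agree j λ ())

agreeOutside-update : ∀ {L} (xs ys : Vec A n) i → AgreeOutside (i ∷ L) xs ys →
                      AgreeOutside L (xs [ i ]≔ lookup ys i) ys
agreeOutside-update xs ys i agree j j∉L with j ≟ i
... | yes refl = lookup∘update i xs (lookup ys i)
... | no  j≢i  = ≡.trans (lookup∘update′ j≢i xs (lookup ys i)) (agree j λ
                   { (here j≡i) → j≢i j≡i ; (there j∈L) → j∉L j∈L })

_⊆ₘ_ : Mono n → Mono n → Set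
ν ⊆ₘ m = ∀ j → lookup ν j ≡ true → lookup m j ≡ true

⊆ₘ-update : ∀ (ν m : Mono n) i → ν ⊆ₘ m → (ν [ i ]≔ lookup m i) ⊆ₘ m
⊆ₘ-update ν m i ν⊆m j νⱼ with j ≟ i
... | yes refl = ≡.trans (≡.sym (lookup∘update i ν (lookup m i))) νⱼ
... | no  j≢i  = ν⊆m j (≡.trans (≡.sym (lookup∘update′ j≢i ν (lookup m i))) νⱼ)

⊆ₘ-absent : ∀ (ν m : Mono n) i → ν ⊆ₘ m → lookup m i ≡ false → lookup ν i ≡ false
⊆ₘ-absent ν m i ν⊆m mᵢ with lookup ν i in νᵢ
... | false = refl
... | true  = contradiction (≡.trans (≡.sym (ν⊆m i νᵢ)) mᵢ) true≢false

var : Fin n → Mono n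
var i = replicate _ false [ i ]≔ true

·ₘ-identityˡ : (ν : Mono n) → replicate n false ·ₘ ν ≡ ν
·ₘ-identityˡ ν = ≡.trans (zipWith-replicate₁ _∨_ false ν) (map-id ν)

var-·ₘ : ∀ (i : Fin n) ν → var i ·ₘ ν ≡ ν [ i ]≔ true
var-·ₘ zero    (_ ∷ ν) = ≡.cong (true ∷_) (·ₘ-identityˡ ν)
var-·ₘ (suc i) (b ∷ ν) = ≡.cong (b ∷_) (var-·ₘ i ν)

var-disjoint : ∀ (ν : Mono n) i → lookup ν i ≡ false → Disjoint (var i) ν
var-disjoint (_ ∷ _) zero    νᵢ zero    = νᵢ
var-disjoint (_ ∷ ν) zero    νᵢ (suc j) = ≡.cong (_∧ lookup ν j) (lookup-replicate j false)
var-disjoint (_ ∷ _) (suc i) νᵢ zero    = refl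
var-disjoint (_ ∷ ν) (suc i) νᵢ (suc j) = var-disjoint ν i νᵢ j

deg-insert : ∀ (ν : Mono n) i → lookup ν i ≡ false → deg (ν [ i ]≔ true) ≡ suc (deg ν)
deg-insert (false ∷ ν) zero    refl = refl
deg-insert (true  ∷ ν) (suc i) νᵢ   = ≡.cong suc (deg-insert ν i νᵢ)
deg-insert (false ∷ ν) (suc i) νᵢ   = deg-insert ν i νᵢ

insert-delete : ∀ (μ : Mono n) i → lookup μ i ≡ true → (μ [ i ]≔ false) [ i ]≔ true ≡ μ
insert-delete μ i μᵢ = ≡.trans ([]≔-idempotent μ i) (update-id μ i μᵢ)

delete-insert : ∀ (ν : Mono n) i → lookup ν i ≡ false → (ν [ i ]≔ true) [ i ]≔ false ≡ ν
delete-insert ν i νᵢ = ≡.trans ([]≔-idempotent ν i) (update-id ν i νᵢ)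

insert-preimage : ∀ (ν : Mono n) {μ} i → ν [ i ]≔ true ≡ μ → ν ≡ μ ⊎ ν ≡ μ [ i ]≔ false
insert-preimage ν i ν⁺≡μ with lookup ν i in νᵢ
... | true  = inj₁ (≡.trans (≡.sym (update-id ν i νᵢ)) ν⁺≡μ)
... | false = inj₂ (≡.trans (≡.sym (delete-insert ν i νᵢ)) (≡.cong (_[ i ]≔ false) ν⁺≡μ))

insert-≢ : ∀ (ν : Mono n) {μ} i → lookup μ i ≡ false → ν [ i ]≔ true ≢ μ
insert-≢ ν i μᵢ ν⁺≡μ =
  true≢false (≡.trans (≡.sym (lookup∘update i ν true)) (≡.trans (≡.cong (λ ξ → lookup ξ i) ν⁺≡μ) μᵢ))

restrictMono-⊆ : ∀ {c ℓ} (F : Field c ℓ) {n} (ρ : Poly.PAssign F n) m → Poly.restrictMono F n ρ m ⊆ₘ m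
restrictMono-⊆ F ρ m j restrictⱼ =
  ∧-conicalˡ _ _ (≡.trans (≡.sym (lookup-zipWith (λ b r → b ∧ is-nothing r) j m ρ)) restrictⱼ)

module Coefficients {c ℓ} (F : Field c ℓ) (n : ℕ) where
  open Field F
  open Poly F n
  open import Relation.Binary.Reasoning.Setoid setoid

  constₚ : Carrier → Pol
  constₚ k = [ (k , replicate n false) ]

  varₚ : Fin n → Pol
  varₚ i = [ (1# , var i) ]

  _*ₜ_ : TermRep → TermRep → TermRep
  t *ₜ u = (proj₁ t * proj₁ u , proj₂ t ·ₘ proj₂ u)

  single-*ₚ : ∀ t Q → [ t ] *ₚ Q ≡ map (t *ₜ_) Q
  single-*ₚ t Q = ++-identityʳ (map (t *ₜ_) Q)

  coeff-++ : ∀ p q μ → coeff (p ++ q) μ ≈ coeff p μ + coeff q μ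
  coeff-++ []      q μ = sym (+-identityˡ _)
  coeff-++ (t ∷ p) q μ with proj₂ t ≟ₘ μ
  ... | yes _ = trans (+-congˡ (coeff-++ p q μ)) (sym (+-assoc _ _ _))
  ... | no  _ = trans (+-congˡ (coeff-++ p q μ)) (sym (+-assoc _ _ _))

  coeff-single-≡ : ∀ x {ν μ} → ν ≡ μ → coeff [ (x , ν) ] μ ≈ x
  coeff-single-≡ x {ν} {μ} ν≡μ with ν ≟ₘ μ
  ... | yes _   = +-identityʳ x
  ... | no  ν≢μ = contradiction ν≡μ ν≢μ

  coeff-single-≢ : ∀ x {ν μ} → ν ≢ μ → coeff [ (x , ν) ] μ ≈ 0#
  coeff-single-≢ x {ν} {μ} ν≢μ with ν ≟ₘ μ
  ... | yes ν≡μ = contradiction ν≡μ ν≢μ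
  ... | no  _   = +-identityʳ 0#

  -- From here on, splitting on ν ≟ₘ μ uses case rather than with: with would also
  -- abstract the test inside coeff, so coeff-single-≡/≢ would no longer fit the goal.
  coeff-single-cong : ∀ {x y} ν μ → x ≈ y → coeff [ (x , ν) ] μ ≈ coeff [ (y , ν) ] μ
  coeff-single-cong ν μ x≈y = case ν ≟ₘ μ of λ
    { (yes ν≡μ) → trans (coeff-single-≡ _ ν≡μ) (trans x≈y (sym (coeff-single-≡ _ ν≡μ)))
    ; (no  ν≢μ) → trans (coeff-single-≢ _ ν≢μ) (sym (coeff-single-≢ _ ν≢μ)) }

  coeff-single-* : ∀ k x ν μ → coeff [ (k * x , ν) ] μ ≈ k * coeff [ (x , ν) ] μ
  coeff-single-* k x ν μ = case ν ≟ₘ μ of λ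
    { (yes ν≡μ) → trans (coeff-single-≡ (k * x) ν≡μ) (*-congˡ (sym (coeff-single-≡ x ν≡μ)))
    ; (no  ν≢μ) → begin
        coeff [ (k * x , ν) ] μ ≈⟨ coeff-single-≢ (k * x) ν≢μ ⟩
        0#                      ≈⟨ sym (zeroʳ k) ⟩
        k * 0#                  ≈⟨ *-congˡ (sym (coeff-single-≢ x ν≢μ)) ⟩
        k * coeff [ (x , ν) ] μ ∎ }

  coeff-single-insert : ∀ x ν {μ} i → lookup μ i ≡ true →
                        coeff [ (x , ν [ i ]≔ true) ] μ
                          ≈ coeff [ (x , ν) ] μ + coeff [ (x , ν) ] (μ [ i ]≔ false)
  coeff-single-insert x ν {μ} i μᵢ = case ν ≟ₘ μ of λ
    { (yes ν≡μ) → begin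
        coeff [ (x , ν [ i ]≔ true) ] μ
          ≈⟨ coeff-single-≡ x (≡.trans (≡.cong (_[ i ]≔ true) ν≡μ) (update-id μ i μᵢ)) ⟩
        x       ≈⟨ sym (+-identityʳ x) ⟩
        x + 0#  ≈⟨ sym (+-cong (coeff-single-≡ x ν≡μ) (coeff-single-≢ x (≢μ⁻ ν≡μ))) ⟩
        coeff [ (x , ν) ] μ + coeff [ (x , ν) ] μ⁻ ∎
    ; (no ν≢μ) → case ν ≟ₘ μ⁻ of λ
      { (yes ν≡μ⁻) → begin
          coeff [ (x , ν [ i ]≔ true) ] μ
            ≈⟨ coeff-single-≡ x (≡.trans (≡.cong (_[ i ]≔ true) ν≡μ⁻) (insert-delete μ i μᵢ)) ⟩
          x       ≈⟨ sym (+-identityˡ x) ⟩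
          0# + x  ≈⟨ sym (+-cong (coeff-single-≢ x ν≢μ) (coeff-single-≡ x ν≡μ⁻)) ⟩
          coeff [ (x , ν) ] μ + coeff [ (x , ν) ] μ⁻ ∎
      ; (no ν≢μ⁻) → begin
          coeff [ (x , ν [ i ]≔ true) ] μ
            ≈⟨ coeff-single-≢ x (λ ν⁺≡μ → [ ν≢μ , ν≢μ⁻ ]′ (insert-preimage ν i ν⁺≡μ)) ⟩
          0#      ≈⟨ sym (+-identityˡ 0#) ⟩
          0# + 0# ≈⟨ sym (+-cong (coeff-single-≢ x ν≢μ) (coeff-single-≢ x ν≢μ⁻)) ⟩
          coeff [ (x , ν) ] μ + coeff [ (x , ν) ] μ⁻ ∎ } }
    where
    μ⁻ = μ [ i ]≔ false
    ≢μ⁻ : ν ≡ μ → ν ≢ μ⁻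
    ≢μ⁻ refl = update-≢ μ i λ μᵢ≡false → true≢false (≡.trans (≡.sym μᵢ) μᵢ≡false)

  coeff-map-scale : ∀ (g : TermRep → TermRep) k μ →
                    (∀ t → coeff [ g t ] μ ≈ k * coeff [ t ] μ) →
                    ∀ Q → coeff (map g Q) μ ≈ k * coeff Q μ
  coeff-map-scale g k μ termwise []      = sym (zeroʳ k)
  coeff-map-scale g k μ termwise (t ∷ Q) = begin
    coeff (g t ∷ map g Q) μ             ≈⟨ coeff-++ [ g t ] (map g Q) μ ⟩
    coeff [ g t ] μ + coeff (map g Q) μ ≈⟨ +-cong (termwise t) (coeff-map-scale g k μ termwise Q) ⟩
    k * coeff [ t ] μ + k * coeff Q μ   ≈⟨ sym (distribˡ k _ _) ⟩
    k * (coeff [ t ] μ + coeff Q μ)     ≈⟨ *-congˡ (sym (coeff-++ [ t ] Q μ)) ⟩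
    k * coeff (t ∷ Q) μ                 ∎

  coeff-map-merge : ∀ (g : TermRep → TermRep) μ μ₁ μ₂ →
                    (∀ t → coeff [ g t ] μ ≈ coeff [ t ] μ₁ + coeff [ t ] μ₂) →
                    ∀ Q → coeff (map g Q) μ ≈ coeff Q μ₁ + coeff Q μ₂
  coeff-map-merge g μ μ₁ μ₂ termwise []      = sym (+-identityˡ 0#)
  coeff-map-merge g μ μ₁ μ₂ termwise (t ∷ Q) = begin
    coeff (g t ∷ map g Q) μ
      ≈⟨ coeff-++ [ g t ] (map g Q) μ ⟩
    coeff [ g t ] μ + coeff (map g Q) μ
      ≈⟨ +-cong (termwise t) (coeff-map-merge g μ μ₁ μ₂ termwise Q) ⟩
    (coeff [ t ] μ₁ + coeff [ t ] μ₂) + (coeff Q μ₁ + coeff Q μ₂)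
      ≈⟨ interchange +-commutativeSemigroup _ _ _ _ ⟩
    (coeff [ t ] μ₁ + coeff Q μ₁) + (coeff [ t ] μ₂ + coeff Q μ₂)
      ≈⟨ sym (+-cong (coeff-++ [ t ] Q μ₁) (coeff-++ [ t ] Q μ₂)) ⟩
    coeff (t ∷ Q) μ₁ + coeff (t ∷ Q) μ₂
      ∎

  coeff-constₚ-* : ∀ k Q μ → coeff (constₚ k *ₚ Q) μ ≈ k * coeff Q μ
  coeff-constₚ-* k Q μ rewrite single-*ₚ (k , replicate n false) Q =
    coeff-map-scale _ k μ termwise Q
    where
    termwise : ∀ t → coeff [ (k , replicate n false) *ₜ t ] μ ≈ k * coeff [ t ] μ
    termwise (x , ν) rewrite ·ₘ-identityˡ ν = coeff-single-* k x ν μ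

  coeff-varₚ-*-present : ∀ i Q μ → lookup μ i ≡ true →
                         coeff (varₚ i *ₚ Q) μ ≈ coeff Q μ + coeff Q (μ [ i ]≔ false)
  coeff-varₚ-*-present i Q μ μᵢ rewrite single-*ₚ (1# , var i) Q =
    coeff-map-merge _ μ μ (μ [ i ]≔ false) termwise Q
    where
    termwise : ∀ t → coeff [ (1# , var i) *ₜ t ] μ ≈ coeff [ t ] μ + coeff [ t ] (μ [ i ]≔ false)
    termwise (x , ν) rewrite var-·ₘ i ν =
      trans (coeff-single-cong (ν [ i ]≔ true) μ (*-identityˡ x)) (coeff-single-insert x ν i μᵢ)

  coeff-varₚ-*-absent : ∀ i Q μ → lookup μ i ≡ false → coeff (varₚ i *ₚ Q) μ ≈ 0#
  coeff-varₚ-*-absent i Q μ μᵢ rewrite single-*ₚ (1# , var i) Q =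
    trans (coeff-map-scale _ 0# μ termwise Q) (zeroˡ _)
    where
    termwise : ∀ t → coeff [ (1# , var i) *ₜ t ] μ ≈ 0# * coeff [ t ] μ
    termwise (x , ν) rewrite var-·ₘ i ν =
      trans (coeff-single-≢ (1# * x) (insert-≢ ν i μᵢ)) (sym (zeroˡ _))

module LeadingTerms {c ℓ} (F : Field c ℓ) (n : ℕ)
                    (_≺_ : Rel (Mono n) Level.zero) (adm : Admissible n _≺_) where
  open Field F
  open Poly F n
  open Coefficients F n
  open Admissible adm
  open IsStrictTotalOrder isStrictTotalOrder using (irrefl; asym; compare)
    renaming (trans to ≺-trans)
  open import Relation.Binary.Reasoning.Setoid setoid

  ≺-insert : ∀ ν i → lookup ν i ≡ false → ν ≺ (ν [ i ]≔ true)
  ≺-insert ν i νᵢ = deg-mono ν _ (≡.subst (deg ν <_) (≡.sym (deg-insert ν i νᵢ)) (n<1+n (deg ν)))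

  insert-mono-≺ : ∀ {μ ν} i → lookup μ i ≡ false → lookup ν i ≡ false →
                  μ ≺ ν → (μ [ i ]≔ true) ≺ (ν [ i ]≔ true)
  insert-mono-≺ {μ} {ν} i μᵢ νᵢ μ≺ν =
    ≡.subst₂ _≺_ (var-·ₘ i μ) (var-·ₘ i ν) (mul-mono (var i) μ ν μ≺ν (var-disjoint (μ ·ₘ ν) i μνᵢ))
    where
    μνᵢ : lookup (μ ·ₘ ν) i ≡ false
    μνᵢ = ≡.trans (lookup-zipWith _∨_ i μ ν) (≡.cong₂ _∨_ μᵢ νᵢ)

  ≺-delete : ∀ {ν μ} i → lookup ν i ≡ false → lookup μ i ≡ true →
             (ν [ i ]≔ true) ≺ μ → ν ≺ (μ [ i ]≔ false)
  ≺-delete {ν} {μ} i νᵢ μᵢ ν⁺≺μ with compare (μ [ i ]≔ false) ν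
  ... | tri< μ⁻≺ν _ _ = contradiction ν⁺≺μ (asym (≡.subst (_≺ (ν [ i ]≔ true)) (insert-delete μ i μᵢ)
                          (insert-mono-≺ i (lookup∘update i μ false) νᵢ μ⁻≺ν)))
  ... | tri≈ _ μ⁻≡ν _ = contradiction ν⁺≺μ
                          (irrefl (≡.trans (≡.cong (_[ i ]≔ true) (≡.sym μ⁻≡ν)) (insert-delete μ i μᵢ)))
  ... | tri> _ _ ν≺μ⁻ = ν≺μ⁻

  -- IsLT only says that nonzero coefficients lie at or below the leading monomial; as
  -- ≈ is not decidable this yields vanishing above it only up to double negation.
  isLT-vanishes-above : ∀ Q {a ν μ} → IsLT _≺_ Q a ν → ν ≺ μ → ¬ ¬ (coeff Q μ ≈ 0#)
  isLT-vanishes-above Q (_ , _ , below) ν≺μ Qμ≉0 with below _ Qμ≉0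
  ... | inj₁ μ≡ν = irrefl (≡.sym μ≡ν) ν≺μ
  ... | inj₂ μ≺ν = asym ν≺μ μ≺ν

  isLT-constₚ-* : ∀ Q {b m} k {a} → IsLT _≺_ Q b m → a ≉ 0# → k * b ≈ a →
                  IsLT _≺_ (constₚ k *ₚ Q) a m
  isLT-constₚ-* Q {b} {m} k {a} (_ , Qm≈b , below) a≉0 kb≈a = kQm≉0 , kQm≈a , below′
    where
    kQm≈a : coeff (constₚ k *ₚ Q) m ≈ a
    kQm≈a = trans (coeff-constₚ-* k Q m) (trans (*-congˡ Qm≈b) kb≈a)
    kQm≉0 : coeff (constₚ k *ₚ Q) m ≉ 0#
    kQm≉0 kQm≈0 = a≉0 (trans (sym kQm≈a) kQm≈0)
    below′ : ∀ μ → coeff (constₚ k *ₚ Q) μ ≉ 0# → μ ≡ m ⊎ μ ≺ m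
    below′ μ kQμ≉0 = below μ λ Qμ≈0 →
      kQμ≉0 (trans (coeff-constₚ-* k Q μ) (trans (*-congˡ Qμ≈0) (zeroʳ k)))

  isLT-varₚ-* : ∀ Q {a ν} i → lookup ν i ≡ false → IsLT _≺_ Q a ν →
                ¬ ¬ IsLT _≺_ (varₚ i *ₚ Q) a (ν [ i ]≔ true)
  isLT-varₚ-* Q {ν = ν} i νᵢ LT@(Qν≉0 , Qν≈a , _) ¬LT′ =
    isLT-vanishes-above Q LT ν≺ν⁺ λ Qν⁺≈0 →
      ¬LT′ ( (λ xQν⁺≈0 → Qν≉0 (trans (sym (xQν⁺≈Qν Qν⁺≈0)) xQν⁺≈0))
           , trans (xQν⁺≈Qν Qν⁺≈0) Qν≈a
           , below′ )
    where
    ν⁺ = ν [ i ]≔ true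
    xQ = varₚ i *ₚ Q
    ν≺ν⁺ : ν ≺ ν⁺
    ν≺ν⁺ = ≺-insert ν i νᵢ
    xQν⁺≈Qν : coeff Q ν⁺ ≈ 0# → coeff xQ ν⁺ ≈ coeff Q ν
    xQν⁺≈Qν Qν⁺≈0 = begin
      coeff xQ ν⁺                            ≈⟨ coeff-varₚ-*-present i Q ν⁺ (lookup∘update i ν true) ⟩
      coeff Q ν⁺ + coeff Q (ν⁺ [ i ]≔ false) ≈⟨ +-cong Qν⁺≈0 (reflexive (≡.cong (coeff Q) (delete-insert ν i νᵢ))) ⟩
      0# + coeff Q ν                         ≈⟨ +-identityˡ _ ⟩
      coeff Q ν                              ∎
    vanishes-above : ∀ {μ} → ν⁺ ≺ μ → ¬ ¬ (coeff xQ μ ≈ 0#)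
    vanishes-above {μ} ν⁺≺μ with lookup μ i in μᵢ
    ... | false = λ xQμ≉0 → xQμ≉0 (coeff-varₚ-*-absent i Q μ μᵢ)
    ... | true  = λ xQμ≉0 →
      isLT-vanishes-above Q LT (≺-trans ν≺ν⁺ ν⁺≺μ) λ Qμ≈0 →
      isLT-vanishes-above Q LT (≺-delete i νᵢ μᵢ ν⁺≺μ) λ Qμ⁻≈0 →
      xQμ≉0 (trans (coeff-varₚ-*-present i Q μ μᵢ) (trans (+-cong Qμ≈0 Qμ⁻≈0) (+-identityʳ 0#)))
    below′ : ∀ μ → coeff xQ μ ≉ 0# → μ ≡ ν⁺ ⊎ μ ≺ ν⁺
    below′ μ xQμ≉0 with compare μ ν⁺
    ... | tri< μ≺ν⁺ _ _ = inj₂ μ≺ν⁺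
    ... | tri≈ _ μ≡ν⁺ _ = inj₁ μ≡ν⁺
    ... | tri> _ _ ν⁺≺μ = ⊥-elim (vanishes-above ν⁺≺μ xQμ≉0)

module IrreducibleTerms {c ℓ ℓ'} (F : Field c ℓ) (n : ℕ)
                        (_≺_ : Rel (Mono n) Level.zero) (adm : Admissible n _≺_)
                        (I : Poly.Pol F n → Set ℓ') (isIdeal : Poly.IsIdeal F n I) where
  open Field F
  open Poly F n
  open IsIdeal isIdeal using (*-closed)
  open Coefficients F n using (constₚ; varₚ)
  open LeadingTerms F n _≺_ adm

  irreducible-rescale : ∀ {a b m} → a ≉ 0# → Irreducible _≺_ I a m → Irreducible _≺_ I b m
  irreducible-rescale {a} {b} a≉0 irr (Q , Q∈I , LT@(Qm≉0 , Qm≈b , _)) =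
    irr (_ , *-closed (constₚ (a * b⁻¹)) Q∈I , isLT-constₚ-* Q (a * b⁻¹) LT a≉0 ab⁻¹b≈a)
    where
    open import Relation.Binary.Reasoning.Setoid setoid
    b⁻¹ : Carrier
    b⁻¹ = proj₁ (inverse b λ b≈0 → Qm≉0 (trans Qm≈b b≈0))
    ab⁻¹b≈a : a * b⁻¹ * b ≈ a
    ab⁻¹b≈a = begin
      a * b⁻¹ * b   ≈⟨ *-assoc a b⁻¹ b ⟩
      a * (b⁻¹ * b) ≈⟨ *-congˡ (*-comm b⁻¹ b) ⟩
      a * (b * b⁻¹) ≈⟨ *-congˡ (proj₂ (inverse b _)) ⟩
      a * 1#        ≈⟨ *-identityʳ a ⟩
      a             ∎

  irreducible-dropVar : ∀ {a ν} i → Irreducible _≺_ I a (ν [ i ]≔ true) → Irreducible _≺_ I a ν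
  irreducible-dropVar {a} {ν} i irr with lookup ν i in νᵢ
  ... | true  = ≡.subst (Irreducible _≺_ I a) (update-id ν i νᵢ) irr
  ... | false = λ (Q , Q∈I , LT) →
    isLT-varₚ-* Q i νᵢ LT λ LT′ → irr (_ , *-closed (varₚ i) Q∈I , LT′)

  irreducible-⊆-agreeOutside : ∀ L {a ν m} → ν ⊆ₘ m → AgreeOutside L ν m →
                               Irreducible _≺_ I a m → Irreducible _≺_ I a ν
  irreducible-⊆-agreeOutside []      {a} ν⊆m agree irr =
    ≡.subst (Irreducible _≺_ I a) (≡.sym (agreeOutside-[]⇒≡ agree)) irr
  irreducible-⊆-agreeOutside (i ∷ L) {a} {ν} {m} ν⊆m agree irr =
    dropUpdate (irreducible-⊆-agreeOutside L (⊆ₘ-update ν m i ν⊆m) (agreeOutside-update ν m i agree) irr)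
    where
    dropUpdate : Irreducible _≺_ I a (ν [ i ]≔ lookup m i) → Irreducible _≺_ I a ν
    dropUpdate with lookup m i in mᵢ
    ... | true  = irreducible-dropVar i
    ... | false = ≡.subst (Irreducible _≺_ I a) (update-id ν i (⊆ₘ-absent ν m i ν⊆m mᵢ))

  irreducible-⊆ : ∀ {a ν m} → ν ⊆ₘ m → Irreducible _≺_ I a m → Irreducible _≺_ I a ν
  irreducible-⊆ ν⊆m = irreducible-⊆-agreeOutside (allFin n) ν⊆m λ j j∉ → contradiction (∈-allFin j) j∉

mainTheorem13 : ∀ {c ℓ ℓ'} (F : Field c ℓ) (n : ℕ)
    (_≺_ : Rel (Mono n) Level.zero) → Admissible n _≺_ →
    let open Field F
        open Poly F n
    in (I : Pol → Set ℓ') → IsIdeal I →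
       (a : Carrier) (m : Mono n) → a ≉ 0# →
       Irreducible _≺_ I a m →
       (ρ : PAssign) → DomWithin ρ m →
       restrictCoeff ρ a m ≉ 0# →
       Irreducible _≺_ I (restrictCoeff ρ a m) (restrictMono ρ m)
mainTheorem13 F n _≺_ adm I isIdeal a m a≉0 irr ρ _ _ =
  irreducible-⊆ (restrictMono-⊆ F ρ m) (irreducible-rescale a≉0 irr)
  where open IrreducibleTerms F n _≺_ adm I isIdeal
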